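{- Let $G$ be a signed graph which contains the complete signed graph with loops $B_n$ as a subgraph, let $k$ be a positive integer, and let $\gamma$ be a proper $k$-coloring of $B_n$. Let $C$ be the set of proper $k$-colorings of $G$ whose restrictions to the vertex set of $B_n$ are equal to $\gamma$. Then $$|C|=\frac{\chi(G,2k+1)}{\chi(B_n,2k+1)}.$$
   Context: A signed graph $G=(G^+,G^-,L_G)$ consists of simple graphs $G^+=(V_G,E_G^+)$, $G^-=(V_G,E_G^-)$ on a common finite vertex set and a loop set $L_G\subseteq V_G$. $F$ is a subgraph of $G$ if $F^+,F^-$ are subgraphs of $G^+,G^-$ on a common vertex set $V_F\subseteq V_G$ and $L_F\subseteq L_G$. $B_n=(K_n,K_n,V)$ is the signed graph on $n$ vertices $V$ in which every pair of distinct vertices is joined by both a positive and a negative edge and every vertex has a loop. With $\Lambda_k=\{0,\pm1,\dots,\pm k\}$, a proper $k$-coloring of $G$ is a map $\gamma:V_G\to\Lambda_k$ with $\gamma(u)\ne\gamma(v)$ for $\{u,v\}\in E_G^+$, $\gamma(u)\ne-\gamma(v)$ for $\{u,v\}\in E_G^-$, and $\gamma(v)\ne0$ for $v\in L_G$. The chromatic polynomial $\chi(G,t)$ is the polynomial such that $\chi(G,2k+1)$ equals the number of proper $k$-colorings of $G$ for every $k\ge1$. -}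

module Defs where

open import Data.Bool using (Bool; true; false; not)
open import Data.Nat as ℕ using (ℕ; zero; suc)
open import Data.Integer as ℤ using (ℤ; +_; -[1+_]; -_; ∣_∣)
open import Data.Fin using (Fin)
import Data.Fin.Properties as FinP
open import Data.List using (List; []; _∷_; map; concatMap; filter; length; upTo)
import Data.Vec.Functional as VF
open import Data.Product using (_×_; _,_)
open import Relation.Nullary using (¬_; Dec; yes; no; ¬?; _×-dec_; _→-dec_)
open import Relation.Nullary.Decidable using (⌊_⌋)
open import Relation.Binary.PropositionalEquality using (_≡_; _≢_)
open import Data.Bool.Properties using () renaming (_≟_ to _≟ᵇ_)

record SignedGraph (m : ℕ) : Set where
  field
    E⁺      : Fin m → Fin m → Bool
    E⁻      : Fin m → Fin m → Bool
    L       : Fin m → Bool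
    E⁺-sym  : ∀ u v → E⁺ u v ≡ E⁺ v u
    E⁻-sym  : ∀ u v → E⁻ u v ≡ E⁻ v u
    E⁺-irr  : ∀ v → E⁺ v v ≡ false
    E⁻-irr  : ∀ v → E⁻ v v ≡ false
open SignedGraph public

neq : ∀ {n} → Fin n → Fin n → Bool
neq i j = not ⌊ i FinP.≟ j ⌋

neq-sym : ∀ {n} (i j : Fin n) → neq i j ≡ neq j i
neq-sym i j with i FinP.≟ j | j FinP.≟ i
... | yes _ | yes _ = _≡_.refl
... | no _  | no _  = _≡_.refl
... | yes p | no q  = Relation.Nullary.contradiction (Relation.Binary.PropositionalEquality.sym p) q
  where import Relation.Nullary
... | no p  | yes q = Relation.Nullary.contradiction (Relation.Binary.PropositionalEquality.sym q) p
  where import Relation.Nullary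

neq-irr : ∀ {n} (i : Fin n) → neq i i ≡ false
neq-irr i with i FinP.≟ i
... | yes _ = _≡_.refl
... | no p  = Relation.Nullary.contradiction _≡_.refl p
  where import Relation.Nullary

B : (n : ℕ) → SignedGraph n
B n = record
  { E⁺ = neq ; E⁻ = neq ; L = λ _ → true
  ; E⁺-sym = neq-sym ; E⁻-sym = neq-sym ; E⁺-irr = neq-irr ; E⁻-irr = neq-irr }

IsSubgraphVia : ∀ {n m} → SignedGraph n → SignedGraph m → (Fin n → Fin m) → Set
IsSubgraphVia F G ι =
  (∀ i j → ι i ≡ ι j → i ≡ j) ×
  (∀ i j → E⁺ F i j ≡ true → E⁺ G (ι i) (ι j) ≡ true) ×
  (∀ i j → E⁻ F i j ≡ true → E⁻ G (ι i) (ι j) ≡ true) ×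
  (∀ i → L F i ≡ true → L G (ι i) ≡ true)

InΛ : ℕ → ℤ → Set
InΛ k z = ∣ z ∣ ℕ.≤ k

IsProperColoring : ∀ {m} → SignedGraph m → ℕ → (Fin m → ℤ) → Set
IsProperColoring G k γ =
  (∀ v → InΛ k (γ v)) ×
  (∀ u v → E⁺ G u v ≡ true → γ u ≢ γ v) ×
  (∀ u v → E⁻ G u v ≡ true → γ u ≢ - γ v) ×
  (∀ v → L G v ≡ true → γ v ≢ + 0)

isProperColoring? : ∀ {m} (G : SignedGraph m) k γ → Dec (IsProperColoring G k γ)
isProperColoring? G k γ =
  FinP.all? (λ v → ∣ γ v ∣ ℕ.≤? k) ×-dec
  (FinP.all? λ u → FinP.all? λ v → (E⁺ G u v ≟ᵇ true) →-dec ¬? (γ u ℤ.≟ γ v)) ×-dec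
  (FinP.all? λ u → FinP.all? λ v → (E⁻ G u v ≟ᵇ true) →-dec ¬? (γ u ℤ.≟ - γ v)) ×-dec
  (FinP.all? λ v → (L G v ≟ᵇ true) →-dec ¬? (γ v ℤ.≟ + 0))

Λlist : ℕ → List ℤ
Λlist k = + 0 ∷ concatMap (λ i → + suc i ∷ -[1+ i ] ∷ []) (upTo k)

allMaps : ∀ {A : Set} → List A → (m : ℕ) → List (Fin m → A)
allMaps xs zero    = (λ ()) ∷ []
allMaps xs (suc m) = concatMap (λ x → map (λ f → x VF.∷ f) (allMaps xs m)) xs

properColorings : ∀ {m} → SignedGraph m → ℕ → List (Fin m → ℤ)
properColorings {m} G k = filter (isProperColoring? G k) (allMaps (Λlist k) m)

-- χ(G, 2k+1) = number of proper k-colorings of G (definition of χ at 2k+1).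
χ-at : ∀ {m} → SignedGraph m → ℕ → ℕ
χ-at G k = length (properColorings G k)

Extends : ∀ {n m} → (Fin n → Fin m) → (Fin n → ℤ) → (Fin m → ℤ) → Set
Extends ι γ c = ∀ i → c (ι i) ≡ γ i

extends? : ∀ {n m} ι γ (c : Fin m → ℤ) → Dec (Extends {n} ι γ c)
extends? ι γ c = FinP.all? λ i → c (ι i) ℤ.≟ γ i

extensions : ∀ {n m} → SignedGraph m → ℕ → (Fin n → Fin m) → (Fin n → ℤ) → List (Fin m → ℤ)
extensions G k ι γ = filter (extends? ι γ) (properColorings G k)

-- Write E(δ) for the number of proper k-colourings of G whose restriction to
-- ι(V_{B_n}) is δ.  The restriction of a proper colouring of G is a proper colouring
--     of B_n, and it is the only colouring δ of B_n that it extends; so double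
--     counting gives  χ(G) = Σ_{δ proper on B_n} E(δ).
--   * Symmetry.  An odd involution σ of ℤ fixing 0 and preserving Λ_k (a
--     "signed symmetry") maps proper colourings to proper colourings and
--     permutes the enumeration of all colourings, hence E(σ ∘ δ) = E(δ).
--     Since a proper colouring of B_n takes nonzero values of pairwise distinct
--     absolute values, any such δ is carried to γ one vertex at a time by
--     transpositions of absolute values and sign flips.  So E is constant.
-- Together: χ(G) = χ(B_n) · E(γ).
module Submission where

open import Defs
open import Data.Nat using (ℕ; _≤_; _*_)
open import Data.Integer using (ℤ)
open import Data.Fin using (Fin)
open import Data.List using (length)
open import Relation.Binary.PropositionalEquality using (_≡_)

open import Data.Bool using (true; false; if_then_else_)
open import Data.Nat as N using (zero; suc; _+_; _<_; z≤n)
import Data.Nat.Properties as NP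
open import Data.Nat.ListAction using (sum)
open import Data.Nat.ListAction.Properties using (sum-↭)
open import Data.Integer as Z using (+_; -[1+_]; -_; ∣_∣)
import Data.Integer.Properties as ZP
open import Data.Fin as Fin using (toℕ; fromℕ<)
import Data.Fin.Properties as FP
open import Data.List using (List; []; _∷_; map; filter; concatMap; upTo; _++_)
import Data.List.Properties as LP
open import Data.List.Relation.Unary.All as All using (All; []; _∷_)
open import Data.List.Relation.Unary.AllPairs using ([]; _∷_)
open import Data.List.Relation.Unary.Any using (here; there)
open import Data.List.Membership.Propositional using (_∈_)
import Data.List.Membership.Propositional.Properties as MP
open import Data.List.Membership.Propositional.Properties.WithK using (unique∧set⇒bag)
open import Data.List.Relation.Unary.Unique.Propositional using (Unique)
import Data.List.Relation.Unary.Unique.Propositional.Properties as UP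
open import Data.List.Relation.Binary.Permutation.Propositional using (_↭_)
import Data.List.Relation.Binary.Permutation.Propositional.Properties as PP
open import Data.List.Relation.Binary.BagAndSetEquality using (∼bag⇒↭)
import Data.Vec.Functional as VF
open import Data.Product using (Σ; ∃; _×_; _,_; proj₁; proj₂)
open import Data.Sum using (_⊎_; inj₁; inj₂)
open import Data.Empty using (⊥; ⊥-elim)
open import Relation.Nullary using (Dec; yes; no; ¬_; does; _×-dec_)
open import Relation.Binary.PropositionalEquality
  using (refl; sym; trans; cong; cong₂; subst; _≢_; module ≡-Reasoning)
open import Function using (_∘_; mk⇔)
import Algebra.Properties.CommutativeSemigroup NP.+-commutativeSemigroup as +-CS

count : {A : Set} {P : A → Set} → (∀ x → Dec (P x)) → List A → ℕ
count P? xs = length (filter P? xs)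

indicator : {A : Set} {P : A → Set} → (∀ x → Dec (P x)) → A → ℕ
indicator P? x = if does (P? x) then 1 else 0

indicator-yes : {A : Set} {P : A → Set} (P? : ∀ x → Dec (P x)) → ∀ x → P x → indicator P? x ≡ 1
indicator-yes P? x p with P? x
... | yes _ = refl
... | no ¬p = ⊥-elim (¬p p)

indicator-no : {A : Set} {P : A → Set} (P? : ∀ x → Dec (P x)) → ∀ x → ¬ P x → indicator P? x ≡ 0
indicator-no P? x ¬p with P? x
... | yes p = ⊥-elim (¬p p)
... | no _ = refl

count-∷ : {A : Set} {P : A → Set} (P? : ∀ x → Dec (P x)) → ∀ x xs →
  count P? (x ∷ xs) ≡ indicator P? x + count P? xs
count-∷ P? x xs with does (P? x)
... | true = refl
... | false = refl

count-cong : {A : Set} {P Q : A → Set} (P? : ∀ x → Dec (P x)) (Q? : ∀ x → Dec (Q x)) →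
  (∀ x → P x → Q x) → (∀ x → Q x → P x) → ∀ xs → count P? xs ≡ count Q? xs
count-cong P? Q? to from [] = refl
count-cong P? Q? to from (x ∷ xs) with P? x | Q? x
... | yes _ | yes _ = cong suc (count-cong P? Q? to from xs)
... | yes p | no ¬q = ⊥-elim (¬q (to x p))
... | no ¬p | yes q = ⊥-elim (¬p (from x q))
... | no _  | no _  = count-cong P? Q? to from xs

count-filter : {A : Set} {P Q : A → Set} (P? : ∀ x → Dec (P x)) (Q? : ∀ x → Dec (Q x)) →
  ∀ xs → count Q? (filter P? xs) ≡ count (λ x → P? x ×-dec Q? x) xs
count-filter P? Q? [] = refl
count-filter P? Q? (x ∷ xs) with does (P? x)
... | false = count-filter P? Q? xs
... | true with does (Q? x)
...   | true = cong suc (count-filter P? Q? xs)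
...   | false = count-filter P? Q? xs

count-map : {A B : Set} {P : B → Set} (P? : ∀ y → Dec (P y)) (g : A → B) → ∀ xs →
  count P? (map g xs) ≡ count (P? ∘ g) xs
count-map P? g [] = refl
count-map P? g (x ∷ xs) with does (P? (g x))
... | true = cong suc (count-map P? g xs)
... | false = count-map P? g xs

count-++ : {A : Set} {P : A → Set} (P? : ∀ x → Dec (P x)) → ∀ xs ys →
  count P? (xs ++ ys) ≡ count P? xs + count P? ys
count-++ P? xs ys = trans (cong length (LP.filter-++ P? xs ys)) (LP.length-++ (filter P? xs))

count-concatMap : {A B : Set} {P : B → Set} (P? : ∀ y → Dec (P y)) (f : A → List B) → ∀ xs →
  count P? (concatMap f xs) ≡ sum (map (λ x → count P? (f x)) xs)
count-concatMap P? f [] = refl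
count-concatMap P? f (x ∷ xs) =
  trans (count-++ P? (f x) (concatMap f xs)) (cong (count P? (f x) N.+_) (count-concatMap P? f xs))

sum-indicator : {A : Set} {P : A → Set} (P? : ∀ x → Dec (P x)) → ∀ xs →
  sum (map (indicator P?) xs) ≡ count P? xs
sum-indicator P? [] = refl
sum-indicator P? (x ∷ xs) =
  trans (cong (indicator P? x N.+_) (sum-indicator P? xs)) (sym (count-∷ P? x xs))

count-none : {A : Set} {P : A → Set} (P? : ∀ x → Dec (P x)) → ∀ xs →
  (∀ x → x ∈ xs → ¬ P x) → count P? xs ≡ 0
count-none P? [] none = refl
count-none P? (x ∷ xs) none with P? x
... | yes p = ⊥-elim (none x (here refl) p)
... | no _ = count-none P? xs (λ y y∈xs → none y (there y∈xs))

count-unique : {A : Set} (_≟_ : (a b : A) → Dec (a ≡ b)) (z : A) → ∀ xs →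
  Unique xs → z ∈ xs → count (_≟ z) xs ≡ 1
count-unique _≟_ z (x ∷ xs) (x∉xs ∷ _) (here refl) with x ≟ x
... | yes _ = cong suc (count-none (_≟ x) xs (λ y y∈xs y≡x → All.lookup x∉xs y∈xs (sym y≡x)))
... | no x≢x = ⊥-elim (x≢x refl)
count-unique _≟_ z (x ∷ xs) (x∉xs ∷ u) (there z∈xs) with x ≟ z
... | yes refl = ⊥-elim (All.lookup x∉xs z∈xs refl)
... | no _ = count-unique _≟_ z xs u z∈xs

sum-map-+ : {A : Set} (f g : A → ℕ) → ∀ xs →
  sum (map (λ x → f x + g x) xs) ≡ sum (map f xs) + sum (map g xs)
sum-map-+ f g [] = refl
sum-map-+ f g (x ∷ xs) rewrite sum-map-+ f g xs =
  +-CS.interchange (f x) (g x) (sum (map f xs)) (sum (map g xs))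

sum-const : {A : Set} (f : A → ℕ) (c : ℕ) → ∀ xs → (∀ x → x ∈ xs → f x ≡ c) →
  sum (map f xs) ≡ length xs * c
sum-const f c [] _ = refl
sum-const f c (x ∷ xs) const =
  cong₂ _+_ (const x (here refl)) (sum-const f c xs (λ y y∈xs → const y (there y∈xs)))

double-count : {A B : Set} {R : B → A → Set} (R? : ∀ p x → Dec (R p x)) (ps : List B) →
  ∀ xs → All (λ x → count (λ p → R? p x) ps ≡ 1) xs →
  length xs ≡ sum (map (λ p → count (R? p) xs) ps)
double-count R? ps [] [] =
  sym (trans (sum-const (λ _ → 0) 0 ps (λ _ _ → refl)) (NP.*-zeroʳ (length ps)))
double-count R? ps (x ∷ xs) (once ∷ onces) = sym (begin
    sum (map (λ p → count (R? p) (x ∷ xs)) ps)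
      ≡⟨ cong sum (LP.map-cong (λ p → count-∷ (R? p) x xs) ps) ⟩
    sum (map (λ p → indicator (R? p) x + count (R? p) xs) ps)
      ≡⟨ sum-map-+ (λ p → indicator (R? p) x) (λ p → count (R? p) xs) ps ⟩
    sum (map (λ p → indicator (R? p) x) ps) + sum (map (λ p → count (R? p) xs) ps)
      ≡⟨ cong₂ _+_ (trans (sum-indicator (λ p → R? p x) ps) once) (sym (double-count R? ps xs onces)) ⟩
    suc (length xs) ∎)
  where open ≡-Reasoning

private
  pair : ℕ → List ℤ
  pair i = + suc i ∷ -[1+ i ] ∷ []

  pairs-abs : ∀ {z} xs → z ∈ concatMap pair xs → ∃ λ y → y ∈ xs × ∣ z ∣ ≡ suc y
  pairs-abs (x ∷ xs) (here refl) = x , here refl , refl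
  pairs-abs (x ∷ xs) (there (here refl)) = x , here refl , refl
  pairs-abs (x ∷ xs) (there (there z∈)) with pairs-abs xs z∈
  ... | y , y∈xs , e = y , there y∈xs , e

  pairs-∈ : ∀ {y} xs → y ∈ xs → (+ suc y ∈ concatMap pair xs) × (-[1+ y ] ∈ concatMap pair xs)
  pairs-∈ (x ∷ xs) (here refl) = here refl , there (here refl)
  pairs-∈ (x ∷ xs) (there y∈xs) with pairs-∈ xs y∈xs
  ... | p , n = there (there p) , there (there n)

  pairs-unique : ∀ xs → Unique xs → Unique (concatMap pair xs)
  pairs-unique [] [] = []
  pairs-unique (x ∷ xs) (x∉xs ∷ u) =
    ((λ ()) ∷ All.tabulate (λ w∈ e → fresh (+ suc x) w∈ e refl)) ∷
    All.tabulate (λ w∈ e → fresh -[1+ x ] w∈ e refl) ∷ pairs-unique xs u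
    where
    fresh : ∀ w {z} → z ∈ concatMap pair xs → w ≡ z → ∣ w ∣ ≡ suc x → ⊥
    fresh w z∈ refl ∣w∣≡ with pairs-abs xs z∈
    ... | y , y∈xs , e = All.lookup x∉xs y∈xs (NP.suc-injective (trans (sym ∣w∣≡) e))

Λ-unique : ∀ k → Unique (Λlist k)
Λ-unique k = All.tabulate (λ z∈ e → nonzero z∈ e) ∷ pairs-unique (upTo k) (UP.upTo⁺ k)
  where
  nonzero : ∀ {z} → z ∈ concatMap pair (upTo k) → + 0 ≡ z → ⊥
  nonzero z∈ refl with pairs-abs (upTo k) z∈
  ... | _ , _ , ()

Λ-∈⁻ : ∀ k {z} → z ∈ Λlist k → InΛ k z
Λ-∈⁻ k (here refl) = z≤n
Λ-∈⁻ k (there z∈) with pairs-abs (upTo k) z∈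
... | y , y∈ , e rewrite e = MP.∈-upTo⁻ y∈

Λ-∈⁺ : ∀ k z → InΛ k z → z ∈ Λlist k
Λ-∈⁺ k (+ zero) _ = here refl
Λ-∈⁺ k (+ suc n) h = there (proj₁ (pairs-∈ (upTo k) (MP.∈-upTo⁺ h)))
Λ-∈⁺ k -[1+ n ] h = there (proj₂ (pairs-∈ (upTo k) (MP.∈-upTo⁺ h)))

≗? : ∀ {m} (r c : Fin m → ℤ) → Dec (∀ i → c i ≡ r i)
≗? r c = FP.all? (λ i → c i Z.≟ r i)

allMaps-once : (xs : List ℤ) → Unique xs → ∀ m (r : Fin m → ℤ) → (∀ i → r i ∈ xs) →
  count (≗? r) (allMaps xs m) ≡ 1
allMaps-once xs u zero r _ =
  trans (count-∷ (≗? r) (λ ()) []) (cong (_+ 0) (indicator-yes (≗? r) (λ ()) (λ ())))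
allMaps-once xs u (suc m) r r∈ = begin
    count (≗? r) (concatMap (λ x → map (x VF.∷_) M) xs)
      ≡⟨ count-concatMap (≗? r) (λ x → map (x VF.∷_) M) xs ⟩
    sum (map (λ x → count (≗? r) (map (x VF.∷_) M)) xs)
      ≡⟨ cong sum (LP.map-cong (λ x → trans (count-map (≗? r) (x VF.∷_) M) (head x (x Z.≟ r₀))) xs) ⟩
    sum (map (indicator (Z._≟ r₀)) xs)
      ≡⟨ sum-indicator (Z._≟ r₀) xs ⟩
    count (Z._≟ r₀) xs
      ≡⟨ count-unique Z._≟_ r₀ xs u (r∈ Fin.zero) ⟩
    1 ∎
  where
  open ≡-Reasoning
  M = allMaps xs m
  r₀ = r Fin.zero
  head : ∀ x → Dec (x ≡ r₀) → count (λ f → ≗? r (x VF.∷ f)) M ≡ indicator (Z._≟ r₀) x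
  head x (yes x≡r₀) =
    trans (count-cong (λ f → ≗? r (x VF.∷ f)) (≗? (r ∘ Fin.suc)) (λ f eq i → eq (Fin.suc i)) cons M)
          (trans (allMaps-once xs u m (r ∘ Fin.suc) (r∈ ∘ Fin.suc))
                 (sym (indicator-yes (Z._≟ r₀) x x≡r₀)))
    where
    cons : ∀ f → (∀ i → f i ≡ r (Fin.suc i)) → ∀ i → (x VF.∷ f) i ≡ r i
    cons f eq Fin.zero = x≡r₀
    cons f eq (Fin.suc i) = eq i
  head x (no x≢r₀) =
    trans (count-none (λ f → ≗? r (x VF.∷ f)) M (λ f _ eq → x≢r₀ (eq Fin.zero)))
          (sym (indicator-no (Z._≟ r₀) x x≢r₀))

count-allMaps-∘ : (σ : ℤ → ℤ) (xs : List ℤ) → map σ xs ↭ xs →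
  ∀ m (P : (Fin m → ℤ) → Set) (P? : ∀ c → Dec (P c)) →
  (∀ c c' → (∀ i → c i ≡ c' i) → P c → P c') →
  count P? (allMaps xs m) ≡ count (λ c → P? (σ ∘ c)) (allMaps xs m)
count-allMaps-∘ σ xs perm zero P P? resp =
  count-cong P? (λ c → P? (σ ∘ c)) (λ c → resp c (σ ∘ c) (λ ())) (λ c → resp (σ ∘ c) c (λ ()))
    (allMaps xs zero)
count-allMaps-∘ σ xs perm (suc m) P P? resp = begin
    count P? (concatMap (λ x → map (x VF.∷_) M) xs)
      ≡⟨ count-concatMap P? (λ x → map (x VF.∷_) M) xs ⟩
    sum (map (λ x → count P? (map (x VF.∷_) M)) xs)
      ≡⟨ cong sum (LP.map-cong (λ x → count-map P? (x VF.∷_) M) xs) ⟩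
    sum (map fibre xs)
      ≡⟨ sum-↭ (PP.map⁺ fibre perm) ⟨
    sum (map fibre (map σ xs))
      ≡⟨ cong sum (LP.map-∘ xs) ⟨
    sum (map (fibre ∘ σ) xs)
      ≡⟨ cong sum (LP.map-cong fibre-σ xs) ⟩
    sum (map (λ x → count (λ c → P? (σ ∘ c)) (map (x VF.∷_) M)) xs)
      ≡⟨ count-concatMap (λ c → P? (σ ∘ c)) (λ x → map (x VF.∷_) M) xs ⟨
    count (λ c → P? (σ ∘ c)) (concatMap (λ x → map (x VF.∷_) M) xs) ∎
  where
  open ≡-Reasoning
  M = allMaps xs m
  fibre : ℤ → ℕ
  fibre y = count (λ f → P? (y VF.∷ f)) M
  σ-∷ : ∀ x f i → (σ ∘ (x VF.∷ f)) i ≡ (σ x VF.∷ (σ ∘ f)) i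
  σ-∷ x f Fin.zero = refl
  σ-∷ x f (Fin.suc i) = refl
  ∷-cong : ∀ y (c c' : Fin m → ℤ) → (∀ i → c i ≡ c' i) → ∀ i → (y VF.∷ c) i ≡ (y VF.∷ c') i
  ∷-cong y c c' eq Fin.zero = refl
  ∷-cong y c c' eq (Fin.suc i) = eq i
  fibre-σ : ∀ x → fibre (σ x) ≡ count (λ c → P? (σ ∘ c)) (map (x VF.∷_) M)
  fibre-σ x = begin
      fibre (σ x)
        ≡⟨ count-allMaps-∘ σ xs perm m (λ f → P (σ x VF.∷ f)) (λ f → P? (σ x VF.∷ f))
             (λ c c' eq → resp _ _ (∷-cong (σ x) c c' eq)) ⟩
      count (λ f → P? (σ x VF.∷ (σ ∘ f))) M
        ≡⟨ count-cong _ _ (λ f → resp _ _ (λ i → sym (σ-∷ x f i))) (λ f → resp _ _ (σ-∷ x f)) M ⟩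
      count (λ f → P? (σ ∘ (x VF.∷ f))) M
        ≡⟨ count-map (λ c → P? (σ ∘ c)) (x VF.∷_) M ⟨
      count (λ c → P? (σ ∘ c)) (map (x VF.∷_) M) ∎

proper-resp : ∀ {m} (G : SignedGraph m) k (c c' : Fin m → ℤ) → (∀ i → c i ≡ c' i) →
  IsProperColoring G k c → IsProperColoring G k c'
proper-resp G k c c' eq (inΛ , pos , neg , loop) =
  (λ v → subst (InΛ k) (eq v) (inΛ v)) ,
  (λ u v E e → pos u v E (trans (eq u) (trans e (sym (eq v))))) ,
  (λ u v E e → neg u v E (trans (eq u) (trans e (cong -_ (sym (eq v)))))) ,
  (λ v Lv e → loop v Lv (trans (eq v) e))

restrict-proper : ∀ {n m} (F : SignedGraph n) (G : SignedGraph m) (ι : Fin n → Fin m) k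
  (c : Fin m → ℤ) → IsSubgraphVia F G ι → IsProperColoring G k c → IsProperColoring F k (c ∘ ι)
restrict-proper F G ι k c (_ , sub⁺ , sub⁻ , subL) (inΛ , pos , neg , loop) =
  (λ v → inΛ (ι v)) ,
  (λ u v E → pos (ι u) (ι v) (sub⁺ u v E)) ,
  (λ u v E → neg (ι u) (ι v) (sub⁻ u v E)) ,
  (λ v Lv → loop (ι v) (subL v Lv))

extensionCount : ∀ {n m} → SignedGraph m → ℕ → (Fin n → Fin m) → (Fin n → ℤ) → ℕ
extensionCount G k ι δ = length (extensions G k ι δ)

extensionCount-resp : ∀ {n m} (G : SignedGraph m) k (ι : Fin n → Fin m) (δ δ' : Fin n → ℤ) →
  (∀ i → δ i ≡ δ' i) → extensionCount G k ι δ ≡ extensionCount G k ι δ'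
extensionCount-resp G k ι δ δ' eq = count-cong (extends? ι δ) (extends? ι δ')
  (λ c e i → trans (e i) (eq i)) (λ c e i → trans (e i) (sym (eq i))) (properColorings G k)

restriction-unique : ∀ {n m} (F : SignedGraph n) (G : SignedGraph m) (ι : Fin n → Fin m) k →
  IsSubgraphVia F G ι → ∀ c → c ∈ properColorings G k →
  count (λ δ → extends? ι δ c) (properColorings F k) ≡ 1
restriction-unique {n} {m} F G ι k sub c c∈ = begin
    count (λ δ → extends? ι δ c) (filter (isProperColoring? F k) M)
      ≡⟨ count-filter (isProperColoring? F k) (λ δ → extends? ι δ c) M ⟩
    count (λ δ → isProperColoring? F k δ ×-dec extends? ι δ c) M
      ≡⟨ count-cong _ (≗? (c ∘ ι)) (λ δ ext i → sym (proj₂ ext i))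
           (λ δ eq → proper-resp F k (c ∘ ι) δ (sym ∘ eq) c|ι-proper , sym ∘ eq) M ⟩
    count (≗? (c ∘ ι)) M
      ≡⟨ allMaps-once (Λlist k) (Λ-unique k) n (c ∘ ι) (λ i → Λ-∈⁺ k (c (ι i)) (proj₁ c|ι-proper i)) ⟩
    1 ∎
  where
  open ≡-Reasoning
  M = allMaps (Λlist k) n
  c|ι-proper : IsProperColoring F k (c ∘ ι)
  c|ι-proper = restrict-proper F G ι k c sub
    (proj₂ (MP.∈-filter⁻ (isProperColoring? G k) {xs = allMaps (Λlist k) m} c∈))

-- An odd involution of ℤ fixing 0 and preserving Λ_k: a relabelling of
-- colours compatible with all three kinds of constraints.
record SignedSymmetry (k : ℕ) (σ : ℤ → ℤ) : Set where
  field
    involutive : ∀ z → σ (σ z) ≡ z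
    odd        : ∀ z → σ (- z) ≡ - σ z
    fixes-zero : σ (+ 0) ≡ + 0
    preserves-Λ : ∀ z → InΛ k z → InΛ k (σ z)

involution-injective : (σ : ℤ → ℤ) → (∀ z → σ (σ z) ≡ z) → ∀ {x y} → σ x ≡ σ y → x ≡ y
involution-injective σ invol {x} {y} e = trans (sym (invol x)) (trans (cong σ e) (invol y))

involution-permutes : (σ : ℤ → ℤ) (xs : List ℤ) → Unique xs → (∀ z → σ (σ z) ≡ z) →
  (∀ {z} → z ∈ xs → σ z ∈ xs) → map σ xs ↭ xs
involution-permutes σ xs u invol closed =
  ∼bag⇒↭ (unique∧set⇒bag (UP.map⁺ (involution-injective σ invol) u) u (mk⇔ to from))
  where
  to : ∀ {z} → z ∈ map σ xs → z ∈ xs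
  to z∈ with MP.∈-map⁻ σ z∈
  ... | w , w∈ , refl = closed w∈
  from : ∀ {z} → z ∈ xs → z ∈ map σ xs
  from {z} z∈ = subst (_∈ map σ xs) (invol z) (MP.∈-map⁺ σ (closed z∈))

module _ {k : ℕ} {σ : ℤ → ℤ} (sym-σ : SignedSymmetry k σ) where
  open SignedSymmetry sym-σ

  σ-injective : ∀ {x y} → σ x ≡ σ y → x ≡ y
  σ-injective = involution-injective σ involutive

  σ-proper : ∀ {m} (G : SignedGraph m) (c : Fin m → ℤ) →
    IsProperColoring G k c → IsProperColoring G k (σ ∘ c)
  σ-proper G c (inΛ , pos , neg , loop) =
    (λ v → preserves-Λ (c v) (inΛ v)) ,
    (λ u v E e → pos u v E (σ-injective e)) ,
    (λ u v E e → neg u v E (σ-injective (trans e (sym (odd (c v)))))) ,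
    (λ v Lv e → loop v Lv (trans (sym (involutive (c v))) (trans (cong σ e) fixes-zero)))

  σ-proper⁻ : ∀ {m} (G : SignedGraph m) (c : Fin m → ℤ) →
    IsProperColoring G k (σ ∘ c) → IsProperColoring G k c
  σ-proper⁻ G c p = proper-resp G k (σ ∘ σ ∘ c) c (involutive ∘ c) (σ-proper G (σ ∘ c) p)

  -- Relabelling the prescribed colouring does not change the extension count:
  -- c ↦ σ ∘ c is a bijection between the two sets of extensions.
  extensionCount-σ : ∀ {n m} (G : SignedGraph m) (ι : Fin n → Fin m) (δ δ' : Fin n → ℤ) →
    (∀ i → δ' i ≡ σ (δ i)) → extensionCount G k ι δ ≡ extensionCount G k ι δ'
  extensionCount-σ {n} {m} G ι δ δ' δ'≡σδ = begin
      count (extends? ι δ) (filter (isProperColoring? G k) M)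
        ≡⟨ count-filter (isProperColoring? G k) (extends? ι δ) M ⟩
      count (Ext? δ) M
        ≡⟨ count-cong (Ext? δ) (λ c → Ext? δ' (σ ∘ c))
             (λ c (p , e) → σ-proper G c p , λ i → trans (cong σ (e i)) (sym (δ'≡σδ i)))
             (λ c (p , e) → σ-proper⁻ G c p , λ i → σ-injective (trans (e i) (δ'≡σδ i))) M ⟩
      count (λ c → Ext? δ' (σ ∘ c)) M
        ≡⟨ count-allMaps-∘ σ (Λlist k) Λ-permuted m (Ext δ') (Ext? δ')
             (λ c c' eq (p , e) → proper-resp G k c c' eq p , λ i → trans (sym (eq (ι i))) (e i)) ⟨
      count (Ext? δ') M
        ≡⟨ count-filter (isProperColoring? G k) (extends? ι δ') M ⟨
      count (extends? ι δ') (filter (isProperColoring? G k) M) ∎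
    where
    open ≡-Reasoning
    M = allMaps (Λlist k) m
    Ext : (Fin n → ℤ) → (Fin m → ℤ) → Set
    Ext ε c = IsProperColoring G k c × Extends ι ε c
    Ext? : ∀ ε c → Dec (Ext ε c)
    Ext? ε c = isProperColoring? G k c ×-dec extends? ι ε c
    Λ-permuted : map σ (Λlist k) ↭ Λlist k
    Λ-permuted = involution-permutes σ (Λlist k) (Λ-unique k) involutive
      (λ {z} z∈ → Λ-∈⁺ k (σ z) (preserves-Λ z (Λ-∈⁻ k z∈)))

transpose : ℕ → ℕ → ℕ → ℕ
transpose a b x with x N.≟ a
... | yes _ = b
... | no _ with x N.≟ b
...   | yes _ = a
...   | no _ = x

transpose-a : ∀ a b → transpose a b a ≡ b
transpose-a a b with a N.≟ a
... | yes _ = refl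
... | no a≢a = ⊥-elim (a≢a refl)

transpose-b : ∀ a b → transpose a b b ≡ a
transpose-b a b with b N.≟ a
... | yes b≡a = b≡a
... | no _ with b N.≟ b
...   | yes _ = refl
...   | no b≢b = ⊥-elim (b≢b refl)

transpose-other : ∀ a b x → x ≢ a → x ≢ b → transpose a b x ≡ x
transpose-other a b x x≢a x≢b with x N.≟ a
... | yes x≡a = ⊥-elim (x≢a x≡a)
... | no _ with x N.≟ b
...   | yes x≡b = ⊥-elim (x≢b x≡b)
...   | no _ = refl

transpose-< : ∀ a b x {K} → a < K → b < K → x < K → transpose a b x < K
transpose-< a b x a<K b<K x<K with x N.≟ a
... | yes _ = b<K
... | no _ with x N.≟ b
...   | yes _ = a<K
...   | no _ = x<K

transpose-involutive : ∀ a b x → transpose a b (transpose a b x) ≡ x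
transpose-involutive a b x = by-cases (x N.≟ a) (x N.≟ b)
  where
  back : ∀ {y} → x ≡ y → transpose a b (transpose a b y) ≡ y → transpose a b (transpose a b x) ≡ x
  back x≡y = subst (λ t → transpose a b (transpose a b t) ≡ t) (sym x≡y)
  by-cases : Dec (x ≡ a) → Dec (x ≡ b) → transpose a b (transpose a b x) ≡ x
  by-cases (yes x≡a) _ = back x≡a (trans (cong (transpose a b) (transpose-a a b)) (transpose-b a b))
  by-cases (no _) (yes x≡b) = back x≡b (trans (cong (transpose a b) (transpose-b a b)) (transpose-a a b))
  by-cases (no x≢a) (no x≢b) =
    trans (cong (transpose a b) (transpose-other a b x x≢a x≢b)) (transpose-other a b x x≢a x≢b)

swapAbs : ℕ → ℕ → ℤ → ℤ
swapAbs a b (+ zero) = + zero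
swapAbs a b (+ suc x) = + suc (transpose a b x)
swapAbs a b -[1+ x ] = -[1+ transpose a b x ]

swapAbs-symmetry : ∀ k a b → a < k → b < k → SignedSymmetry k (swapAbs a b)
swapAbs-symmetry k a b a<k b<k = record
  { involutive = invol ; odd = odd ; fixes-zero = refl ; preserves-Λ = bound }
  where
  invol : ∀ z → swapAbs a b (swapAbs a b z) ≡ z
  invol (+ zero) = refl
  invol (+ suc x) = cong (λ t → + suc t) (transpose-involutive a b x)
  invol -[1+ x ] = cong -[1+_] (transpose-involutive a b x)
  odd : ∀ z → swapAbs a b (- z) ≡ - swapAbs a b z
  odd (+ zero) = refl
  odd (+ suc x) = refl
  odd -[1+ x ] = refl
  bound : ∀ z → InΛ k z → InΛ k (swapAbs a b z)
  bound (+ zero) _ = z≤n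
  bound (+ suc x) x<k = transpose-< a b x a<k b<k x<k
  bound -[1+ x ] x<k = transpose-< a b x a<k b<k x<k

swapAbs-hit : ∀ a b z → ∣ z ∣ ≡ suc a → ∣ swapAbs a b z ∣ ≡ suc b
swapAbs-hit a b (+ suc x) e = cong suc (trans (cong (transpose a b) (NP.suc-injective e)) (transpose-a a b))
swapAbs-hit a b -[1+ x ] e = cong suc (trans (cong (transpose a b) (NP.suc-injective e)) (transpose-a a b))

swapAbs-other : ∀ a b z → ∣ z ∣ ≢ suc a → ∣ z ∣ ≢ suc b → swapAbs a b z ≡ z
swapAbs-other a b (+ zero) _ _ = refl
swapAbs-other a b (+ suc x) ≢a ≢b =
  cong (λ t → + suc t) (transpose-other a b x (≢a ∘ cong suc) (≢b ∘ cong suc))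
swapAbs-other a b -[1+ x ] ≢a ≢b =
  cong -[1+_] (transpose-other a b x (≢a ∘ cong suc) (≢b ∘ cong suc))

flipAt : ℕ → ℤ → ℤ
flipAt b z with ∣ z ∣ N.≟ b
... | yes _ = - z
... | no _ = z

flipAt-hit : ∀ b z → ∣ z ∣ ≡ b → flipAt b z ≡ - z
flipAt-hit b z e with ∣ z ∣ N.≟ b
... | yes _ = refl
... | no ≢b = ⊥-elim (≢b e)

flipAt-other : ∀ b z → ∣ z ∣ ≢ b → flipAt b z ≡ z
flipAt-other b z ≢b with ∣ z ∣ N.≟ b
... | yes e = ⊥-elim (≢b e)
... | no _ = refl

flipAt-symmetry : ∀ k b → SignedSymmetry k (flipAt b)
flipAt-symmetry k b = record
  { involutive = invol ; odd = odd ; fixes-zero = fixes-zero ; preserves-Λ = bound }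
  where
  invol : ∀ z → flipAt b (flipAt b z) ≡ z
  invol z with ∣ z ∣ N.≟ b
  ... | yes e = trans (flipAt-hit b (- z) (trans (ZP.∣-i∣≡∣i∣ z) e)) (ZP.neg-involutive z)
  ... | no ≢b = flipAt-other b z ≢b
  odd : ∀ z → flipAt b (- z) ≡ - flipAt b z
  odd z with ∣ z ∣ N.≟ b
  ... | yes e = flipAt-hit b (- z) (trans (ZP.∣-i∣≡∣i∣ z) e)
  ... | no ≢b = flipAt-other b (- z) (≢b ∘ trans (sym (ZP.∣-i∣≡∣i∣ z)))
  fixes-zero : flipAt b (+ 0) ≡ + 0
  fixes-zero with ∣ + 0 ∣ N.≟ b
  ... | yes _ = refl
  ... | no _ = refl
  bound : ∀ z → InΛ k z → InΛ k (flipAt b z)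
  bound z with ∣ z ∣ N.≟ b
  ... | yes _ = subst (N._≤ k) (sym (ZP.∣-i∣≡∣i∣ z))
  ... | no _ = λ h → h

neq-true : ∀ {n} (u v : Fin n) → u ≢ v → neq u v ≡ true
neq-true u v u≢v with u FP.≟ v
... | yes u≡v = ⊥-elim (u≢v u≡v)
... | no _ = refl

abs-cases : ∀ x y → ∣ x ∣ ≡ ∣ y ∣ → (x ≡ y) ⊎ (x ≡ - y)
abs-cases (+ m) (+ n) e = inj₁ (cong +_ e)
abs-cases (+ m) -[1+ n ] e = inj₂ (cong +_ e)
abs-cases -[1+ m ] (+ n) e = inj₂ (subst (λ t → -[1+ m ] ≡ - (+ t)) e refl)
abs-cases -[1+ m ] -[1+ n ] e = inj₁ (cong -[1+_] (NP.suc-injective e))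

module _ {n k : ℕ} {δ : Fin n → ℤ} (proper : IsProperColoring (B n) k δ) where
  B-abs-distinct : ∀ u v → u ≢ v → ∣ δ u ∣ ≢ ∣ δ v ∣
  B-abs-distinct u v u≢v e with abs-cases (δ u) (δ v) e
  ... | inj₁ δu≡δv  = proj₁ (proj₂ proper) u v (neq-true u v u≢v) δu≡δv
  ... | inj₂ δu≡-δv = proj₁ (proj₂ (proj₂ proper)) u v (neq-true u v u≢v) δu≡-δv

  B-abs-suc : ∀ u → ∃ λ a → ∣ δ u ∣ ≡ suc a × a < k
  B-abs-suc u with ∣ δ u ∣ in eq
  ... | zero = ⊥-elim (proj₂ (proj₂ (proj₂ proper)) u refl (ZP.∣i∣≡0⇒i≡0 eq))
  ... | suc a = a , refl , subst (N._≤ k) eq (proj₁ proper u)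

module Transitivity {n m : ℕ} (G : SignedGraph m) (k : ℕ) (ι : Fin n → Fin m)
                    (γ : Fin n → ℤ) (γ-proper : IsProperColoring (B n) k γ) where

  Proper : (Fin n → ℤ) → Set
  Proper = IsProperColoring (B n) k

  E : (Fin n → ℤ) → ℕ
  E = extensionCount G k ι

  AgreesBelow : ℕ → (Fin n → ℤ) → Set
  AgreesBelow i δ = ∀ j → toℕ j < i → δ j ≡ γ j

  Reachable : ℕ → (Fin n → ℤ) → Set
  Reachable i δ = Σ (Fin n → ℤ) λ δ' → Proper δ' × AgreesBelow i δ' × E δ ≡ E δ'

  module _ (i : ℕ) (i<n : i < n) where
    j₀ : Fin n
    j₀ = fromℕ< i<n

    below-≢ : ∀ j → toℕ j < i → j ≢ j₀
    below-≢ j j<i e = NP.<⇒≢ j<i (trans (cong toℕ e) (FP.toℕ-fromℕ< i<n))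

    γ-abs-fresh : ∀ δ → AgreesBelow i δ → ∀ j → toℕ j < i → ∣ δ j ∣ ≢ ∣ γ j₀ ∣
    γ-abs-fresh δ agree j j<i e =
      B-abs-distinct γ-proper j j₀ (below-≢ j j<i) (trans (cong ∣_∣ (sym (agree j j<i))) e)

    -- Step 1: a transposition of absolute values makes |δ j₀| = |γ j₀|.
    match-abs : ∀ δ → Proper δ → AgreesBelow i δ →
      Σ (Fin n → ℤ) λ δ' → Proper δ' × AgreesBelow i δ' × ∣ δ' j₀ ∣ ≡ ∣ γ j₀ ∣ × E δ ≡ E δ'
    match-abs δ δ-proper agree =
      swapAbs a b ∘ δ , σ-proper σ-sym (B n) δ δ-proper , agree' ,
      trans (swapAbs-hit a b (δ j₀) ∣δj₀∣≡) (sym ∣γj₀∣≡) ,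
      extensionCount-σ σ-sym G ι δ (swapAbs a b ∘ δ) (λ _ → refl)
      where
      a = proj₁ (B-abs-suc δ-proper j₀)
      ∣δj₀∣≡ = proj₁ (proj₂ (B-abs-suc δ-proper j₀))
      b = proj₁ (B-abs-suc γ-proper j₀)
      ∣γj₀∣≡ = proj₁ (proj₂ (B-abs-suc γ-proper j₀))
      σ-sym = swapAbs-symmetry k a b (proj₂ (proj₂ (B-abs-suc δ-proper j₀)))
                                     (proj₂ (proj₂ (B-abs-suc γ-proper j₀)))
      agree' : AgreesBelow i (swapAbs a b ∘ δ)
      agree' j j<i = trans (swapAbs-other a b (δ j)
          (λ e → B-abs-distinct δ-proper j j₀ (below-≢ j j<i) (trans e (sym ∣δj₀∣≡)))
          (λ e → γ-abs-fresh δ agree j j<i (trans e (sym ∣γj₀∣≡))))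
        (agree j j<i)

    extend-agreement : ∀ δ → AgreesBelow i δ → δ j₀ ≡ γ j₀ → AgreesBelow (suc i) δ
    extend-agreement δ agree e j j<1+i with NP.m<1+n⇒m<n∨m≡n j<1+i
    ... | inj₁ j<i = agree j j<i
    ... | inj₂ j≡i = subst (λ t → δ t ≡ γ t)
            (sym (FP.toℕ-injective (trans j≡i (sym (FP.toℕ-fromℕ< i<n))))) e

    -- Step 2: if the absolute values already match, at most a sign flip remains.
    match-sign : ∀ δ → Proper δ → AgreesBelow i δ → ∣ δ j₀ ∣ ≡ ∣ γ j₀ ∣ → Reachable (suc i) δ
    match-sign δ δ-proper agree ∣δj₀∣≡ with abs-cases (δ j₀) (γ j₀) ∣δj₀∣≡
    ... | inj₁ δj₀≡γj₀ = δ , δ-proper , extend-agreement δ agree δj₀≡γj₀ , refl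
    ... | inj₂ δj₀≡-γj₀ =
      flipAt b ∘ δ , σ-proper σ-sym (B n) δ δ-proper ,
      extend-agreement (flipAt b ∘ δ) agree' flipped ,
      extensionCount-σ σ-sym G ι δ (flipAt b ∘ δ) (λ _ → refl)
      where
      b = ∣ γ j₀ ∣
      σ-sym = flipAt-symmetry k b
      agree' : AgreesBelow i (flipAt b ∘ δ)
      agree' j j<i = trans (flipAt-other b (δ j) (γ-abs-fresh δ agree j j<i)) (agree j j<i)
      flipped : flipAt b (δ j₀) ≡ γ j₀
      flipped = trans (flipAt-hit b (δ j₀) ∣δj₀∣≡)
                      (trans (cong -_ δj₀≡-γj₀) (ZP.neg-involutive (γ j₀)))

  reach : ∀ i → i ≤ n → ∀ δ → Proper δ → Reachable i δ
  reach zero _ δ δ-proper = δ , δ-proper , (λ j ()) , refl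
  reach (suc i) i<n δ δ-proper with reach i (NP.<⇒≤ i<n) δ δ-proper
  ... | δ₁ , δ₁-proper , agree₁ , E₁ with match-abs i i<n δ₁ δ₁-proper agree₁
  ... | δ₂ , δ₂-proper , agree₂ , abs≡ , E₂ with match-sign i i<n δ₂ δ₂-proper agree₂ abs≡
  ... | δ₃ , δ₃-proper , agree₃ , E₃ = δ₃ , δ₃-proper , agree₃ , trans E₁ (trans E₂ E₃)

  extensionCount-constant : ∀ δ → Proper δ → E δ ≡ E γ
  extensionCount-constant δ δ-proper with reach n NP.≤-refl δ δ-proper
  ... | δ' , _ , agree , E≡ =
    trans E≡ (extensionCount-resp G k ι δ' γ (λ j → agree j (FP.toℕ<n j)))

-- χ(G) = Σ_δ E(δ) = χ(B_n) · E(γ).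
proposition4p12 :
    (n m : ℕ) (G : SignedGraph m) (ι : Fin n → Fin m) →
    IsSubgraphVia (B n) G ι →
    (k : ℕ) → 1 ≤ k →
    (γ : Fin n → ℤ) → IsProperColoring (B n) k γ →
    length (extensions G k ι γ) * χ-at (B n) k ≡ χ-at G k
proposition4p12 n m G ι sub k _ γ γ-proper = sym (begin
    χ-at G k
      ≡⟨ double-count (λ δ c → extends? ι δ c) Bcol Gcol
           (All.tabulate (restriction-unique (B n) G ι k sub _)) ⟩
    sum (map (extensionCount G k ι) Bcol)
      ≡⟨ sum-const (extensionCount G k ι) (extensionCount G k ι γ) Bcol
           (λ δ δ∈ → extensionCount-constant δ
             (proj₂ (MP.∈-filter⁻ (isProperColoring? (B n) k) {xs = allMaps (Λlist k) n} δ∈))) ⟩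
    χ-at (B n) k * extensionCount G k ι γ
      ≡⟨ NP.*-comm (χ-at (B n) k) (extensionCount G k ι γ) ⟩
    extensionCount G k ι γ * χ-at (B n) k ∎)
  where
  open ≡-Reasoning
  open Transitivity G k ι γ γ-proper using (extensionCount-constant)
  Gcol = properColorings G k
  Bcol = properColorings (B n) k
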